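{- In constructive mathematics, consider the statement: "For any set $X$ with a binary relation $<$, if for all $x,y\in X$, $x\leq_{N}y$ implies $x\leq_{P}y$, then $<$ is cotransitive." This statement implies the weak law of excluded middle: for every proposition $P$, either $\neg P$ or $\neg\neg P$.
   Context: The setting is constructive mathematics: no use of the law of excluded middle. For a set $X$ with a binary relation $<$ and $x,y\in X$: $x\leq_{P}y$ means that for all $z\in X$, $z<x$ implies $z<y$, and $y<z$ implies $x<z$; $x\leq_{N}y$ means $\neg(y<x)$. The relation $<$ is cotransitive if for all $x,y,z\in X$, $x<y$ implies $x<z$ or $z<y$. -}

module Defs where

open import Data.Product using (_×_)
open import Data.Sum using (_⊎_)
open import Relation.Nullary using (¬_)

_≤P_ : {X : Set} → (X → X → Set) → X → X → Set
_≤P_ {X} _<_ x y = (z : X) → (z < x → z < y) × (y < z → x < z)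

_≤N_ : {X : Set} → (X → X → Set) → X → X → Set
_≤N_ _<_ x y = ¬ (y < x)

Cotransitive : {X : Set} → (X → X → Set) → Set
Cotransitive {X} _<_ = (x y z : X) → x < y → (x < z) ⊎ (z < y)

NtoP⇒Cotrans : Set₁
NtoP⇒Cotrans = (X : Set) (_<_ : X → X → Set) →
  ((x y : X) → _≤N_ _<_ x y → _≤P_ _<_ x y) → Cotransitive _<_

WLEM : Set₁
WLEM = (P : Set) → (¬ P) ⊎ (¬ ¬ P)

module Submission where

open import Defs
open import Data.Product using (_,_)
open import Data.Sum using (_⊎_)
open import Data.Unit using (⊤; tt)
open import Data.Empty using (⊥; ⊥-elim)
open import Function using (id)
open import Relation.Nullary using (¬_)
open import Relation.Nullary.Negation using (negated-stable)

-- Take three points lo < mid < hi with lo < hi outright, lo < mid ⇔ A and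
-- mid < hi ⇔ B. When A and B are "negation-complementary", ≤N already implies
-- ≤P on this chain, so cotransitivity of lo < hi at mid decides A ⊎ B.
-- With A = ¬ P and B = ¬ ¬ P this is the weak law of excluded middle.

≤P-refl : {X : Set} (_<_ : X → X → Set) (x : X) → _≤P_ _<_ x x
≤P-refl _<_ x z = id , id

data Three : Set where
  lo mid hi : Three

module _ (A B : Set) where

  chain : Three → Three → Set
  chain lo mid = A
  chain lo hi  = ⊤
  chain mid hi = B
  chain _ _    = ⊥

  chain-≤N⇒≤P : (¬ A → B) → (¬ B → A) →
                (x y : Three) → _≤N_ chain x y → _≤P_ chain x y
  chain-≤N⇒≤P _ _ lo lo _ = ≤P-refl chain lo
  chain-≤N⇒≤P _ _ mid mid _ = ≤P-refl chain mid
  chain-≤N⇒≤P _ _ hi hi _ = ≤P-refl chain hi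
  chain-≤N⇒≤P _ _ lo mid _ lo = (λ ()) , (λ ())
  chain-≤N⇒≤P _ _ lo mid _ mid = (λ ()) , (λ ())
  chain-≤N⇒≤P _ _ lo mid _ hi = (λ ()) , (λ _ → tt)
  chain-≤N⇒≤P _ _ lo hi _ lo = (λ ()) , (λ ())
  chain-≤N⇒≤P _ _ lo hi _ mid = (λ ()) , (λ ())
  chain-≤N⇒≤P _ _ lo hi _ hi = (λ ()) , (λ ())
  chain-≤N⇒≤P _ _ mid hi _ lo = (λ _ → tt) , (λ ())
  chain-≤N⇒≤P _ _ mid hi _ mid = (λ ()) , (λ ())
  chain-≤N⇒≤P _ _ mid hi _ hi = (λ ()) , (λ ())
  chain-≤N⇒≤P _ _ mid lo ¬A lo = ¬A , (λ ())
  chain-≤N⇒≤P _ _ mid lo ¬A mid = (λ ()) , (λ a → ⊥-elim (¬A a))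
  chain-≤N⇒≤P ¬A→B _ mid lo ¬A hi = (λ ()) , (λ _ → ¬A→B ¬A)
  chain-≤N⇒≤P _ _ hi lo ¬⊤ _ = ⊥-elim (¬⊤ tt)
  chain-≤N⇒≤P _ ¬B→A hi mid ¬B lo = (λ _ → ¬B→A ¬B) , (λ ())
  chain-≤N⇒≤P _ _ hi mid ¬B mid = ¬B , (λ ())
  chain-≤N⇒≤P _ _ hi mid ¬B hi = (λ ()) , ¬B

NtoP⇒Cotrans⇒complementary-⊎ : NtoP⇒Cotrans → (A B : Set) →
                                (¬ A → B) → (¬ B → A) → A ⊎ B
NtoP⇒Cotrans⇒complementary-⊎ cotrans A B ¬A→B ¬B→A =
  cotrans Three (chain A B) (chain-≤N⇒≤P A B ¬A→B ¬B→A) lo hi mid tt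

theorem4 : NtoP⇒Cotrans → WLEM
theorem4 cotrans P = NtoP⇒Cotrans⇒complementary-⊎ cotrans (¬ P) (¬ ¬ P) id negated-stable
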